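{- Let $\delta,\delta'$ be probability distributions over the permutations of an $n$-element set $U$ with $d_{TV}(\delta,\delta')\le 1/n$. Then for every request set $S\subseteq U$ of size $r$, $$\mathbb{E}_{\pi\sim\delta'}[\pi(S)]\le 2\,\mathbb{E}_{\pi\sim\delta}[\pi(S)].$$
   Context: For a permutation $\pi$ of $U$ giving each element $e$ a position $\pi[e]\in\{1,\dots,n\}$ and nonempty $S\subseteq U$, $\pi(S)=\min_{e\in S}\pi[e]$. For distributions $\delta,\delta'$ on a finite set, $d_{TV}(\delta,\delta')=\sum_i\max\{0,\delta(i)-\delta'(i)\}$.
   Formalization: The probability distributions δ, δ' over the permutations of U take rational values rather than real ones. -}

module Defs where

open import Data.Bool using (Bool; true; false; if_then_else_)
open import Data.Nat as ℕ using (ℕ; suc; _⊓_)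
open import Data.Integer using (+_)
open import Data.Fin using (Fin; toℕ)
open import Data.Vec using (Vec; []; _∷_; lookup)
open import Data.List using (List; []; _∷_; map; concatMap; foldr; filter)
open import Data.List.Base using (allFin)
open import Data.Rational using (ℚ; 0ℚ; 1ℚ; _+_; _*_; _-_; _⊔_; _≤_)
open import Relation.Binary.PropositionalEquality using (_≡_)
open import Relation.Nullary.Decidable using (T?)
open import Data.Product using (Σ; _×_)
open import Relation.Nullary using (¬_)

-- The universe U is Fin n.  A "permutation candidate" is a vector
-- v : Vec (Fin n) n with v[e] = position of e minus 1 (0-based);
-- it is a permutation iff e ↦ lookup v e is injective.
IsPerm : {n : ℕ} → Vec (Fin n) n → Set
IsPerm {n} v = (i j : Fin n) → lookup v i ≡ lookup v j → i ≡ j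

allVecs : (n k : ℕ) → List (Vec (Fin n) k)
allVecs n ℕ.zero    = [] ∷ []
allVecs n (suc k) = concatMap (λ x → map (x ∷_) (allVecs n k)) (allFin n)

sumℚ : List ℚ → ℚ
sumℚ = foldr _+_ 0ℚ

Σv : (n : ℕ) → (Vec (Fin n) n → ℚ) → ℚ
Σv n f = sumℚ (map f (allVecs n n))

record Distribution (n : ℕ) : Set where
  field
    prob     : Vec (Fin n) n → ℚ
    nonneg   : ∀ v → 0ℚ ≤ prob v
    onPerms  : ∀ v → ¬ IsPerm v → prob v ≡ 0ℚ
    total    : Σv n prob ≡ 1ℚ
open Distribution public

dTV : {n : ℕ} → Distribution n → Distribution n → ℚ
dTV {n} δ δ' = Σv n (λ v → 0ℚ ⊔ (prob δ v - prob δ' v))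

Subset : ℕ → Set
Subset n = Fin n → Bool

Nonempty : {n : ℕ} → Subset n → Set
Nonempty {n} S = Σ (Fin n) (λ e → S e ≡ true)

pos : {n : ℕ} → Vec (Fin n) n → Fin n → ℕ
pos v e = suc (toℕ (lookup v e))

-- minimum of a list of naturals (value 0 on [] is never used, S nonempty)
minList : List ℕ → ℕ
minList []       = 0
minList (x ∷ xs) = foldr _⊓_ x xs

minPos : {n : ℕ} → Vec (Fin n) n → Subset n → ℕ
minPos {n} v S = minList (map (pos v) (filter (λ e → T? (S e)) (allFin n)))

ℕ→ℚ : ℕ → ℚ
ℕ→ℚ k = Data.Rational._/_ (+ k) 1
  where import Data.Rational

expMin : {n : ℕ} → Distribution n → Subset n → ℚ
expMin {n} δ S = Σv n (λ v → prob δ v * ℕ→ℚ (minPos v S))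

card : {n : ℕ} → Subset n → ℕ
card {n} S = Data.List.length (filter (λ e → T? (S e)) (allFin n))
  where import Data.List

module Submission where

-- Shifting mass of total size d_TV(δ',δ) can raise the expectation of a function with
-- values in [0,M] by at most M·d_TV(δ',δ), and for two probability distributions
-- d_TV(δ',δ) = d_TV(δ,δ').  Since 1 ≤ π(S) ≤ n, this gives
-- E_δ'[π(S)] ≤ E_δ[π(S)] + n·(1/n) ≤ 2 E_δ[π(S)].

open import Defs
open import Data.Nat using (ℕ; NonZero)
open import Data.Integer using (+_)
open import Data.Rational using (_≤_; _*_; _/_)
open import Relation.Binary.PropositionalEquality using (_≡_)

open import Data.Nat as ℕ using (suc; _⊓_)
import Data.Nat.Properties as ℕ
import Data.Nat.Coprimality as Coprimality
import Data.Integer as ℤ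
import Data.Integer.Properties as ℤ
open import Data.Rational as ℚ using (ℚ; 0ℚ; 1ℚ; _+_; _-_; -_; _⊔_; mkℚ; *≤*)
open import Data.Rational.Properties
open import Data.Rational.Solver using (module +-*-Solver)
open import Data.List using (List; []; _∷_; map; foldr; filter)
open import Data.List.Base using (allFin)
open import Data.List.Membership.Propositional using (_∈_)
open import Data.List.Membership.Propositional.Properties using (∈-filter⁺; ∈-allFin)
open import Data.Vec using (Vec; lookup)
open import Data.Fin using (Fin)
import Data.Fin.Properties as Fin
open import Data.Bool using (T)
open import Data.Product using (_,_)
open import Data.List.Relation.Unary.All as All using (All; []; _∷_)
import Data.List.Relation.Unary.All.Properties as All
open import Relation.Nullary.Decidable using (T?)
open import Relation.Binary.PropositionalEquality using (refl; sym; cong; cong₂; subst; subst₂; module ≡-Reasoning)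

open +-*-Solver

sumℚ-map-mono : {A : Set} {f g : A → ℚ} → (∀ x → f x ≤ g x) →
                ∀ xs → sumℚ (map f xs) ≤ sumℚ (map g xs)
sumℚ-map-mono f≤g []       = ≤-refl
sumℚ-map-mono f≤g (x ∷ xs) = +-mono-≤ (f≤g x) (sumℚ-map-mono f≤g xs)

sumℚ-map-+ : {A : Set} (f g : A → ℚ) →
             ∀ xs → sumℚ (map (λ x → f x + g x) xs) ≡ sumℚ (map f xs) + sumℚ (map g xs)
sumℚ-map-+ f g []       = refl
sumℚ-map-+ f g (x ∷ xs) rewrite sumℚ-map-+ f g xs =
  solve 4 (λ a b c d → (a :+ b) :+ (c :+ d) := (a :+ c) :+ (b :+ d)) refl
    (f x) (g x) (sumℚ (map f xs)) (sumℚ (map g xs))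

sumℚ-map-neg : {A : Set} (f : A → ℚ) → ∀ xs → sumℚ (map (λ x → - f x) xs) ≡ - sumℚ (map f xs)
sumℚ-map-neg f []       = refl
sumℚ-map-neg f (x ∷ xs) rewrite sumℚ-map-neg f xs = sym (neg-distrib-+ (f x) (sumℚ (map f xs)))

sumℚ-map-*ˡ : {A : Set} (c : ℚ) (f : A → ℚ) →
              ∀ xs → sumℚ (map (λ x → c * f x) xs) ≡ c * sumℚ (map f xs)
sumℚ-map-*ˡ c f []       = sym (*-zeroʳ c)
sumℚ-map-*ˡ c f (x ∷ xs) rewrite sumℚ-map-*ˡ c f xs = sym (*-distribˡ-+ c (f x) (sumℚ (map f xs)))

ℕ→ℚ-mkℚ : ∀ k → ℕ→ℚ k ≡ mkℚ (+ k) 0 (Coprimality.sym (Coprimality.1-coprimeTo k))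
ℕ→ℚ-mkℚ k = normalize-coprime (Coprimality.sym (Coprimality.1-coprimeTo k))

ℕ→ℚ-mono-≤ : ∀ {a b} → a ℕ.≤ b → ℕ→ℚ a ≤ ℕ→ℚ b
ℕ→ℚ-mono-≤ {a} {b} a≤b rewrite ℕ→ℚ-mkℚ a | ℕ→ℚ-mkℚ b =
  *≤* (subst₂ ℤ._≤_ (sym (ℤ.*-identityʳ (+ a))) (sym (ℤ.*-identityʳ (+ b))) (ℤ.+≤+ a≤b))

ℕ→ℚ-*-1/n : ∀ n .{{_ : NonZero n}} → ℕ→ℚ n * ((+ 1) / n) ≡ 1ℚ
ℕ→ℚ-*-1/n (suc m) rewrite ℕ→ℚ-mkℚ (suc m) | normalize-coprime {1} {m} (Coprimality.1-coprimeTo (suc m)) =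
  *-inverseʳ (mkℚ (+ suc m) 0 (Coprimality.sym (Coprimality.1-coprimeTo (suc m))))

foldr-⊓-preserves : (P : ℕ → Set) → (∀ {x y} → P x → P y → P (x ⊓ y)) →
                    ∀ {x xs} → P x → All P xs → P (foldr _⊓_ x xs)
foldr-⊓-preserves P P-⊓ Px []         = Px
foldr-⊓-preserves P P-⊓ Px (Py ∷ Pys) = P-⊓ Py (foldr-⊓-preserves P P-⊓ Px Pys)

minPos-preserves : ∀ {n} (P : ℕ → Set) → (∀ {x y} → P x → P y → P (x ⊓ y)) →
                   (v : Vec (Fin n) n) (S : Subset n) → Nonempty S →
                   (∀ e → P (pos v e)) → P (minPos v S)
minPos-preserves {n} P P-⊓ v S (e , e∈S) P-pos = go (filter (λ e → T? (S e)) (allFin n)) e∈members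
  where
  e∈members : e ∈ filter (λ e → T? (S e)) (allFin n)
  e∈members = ∈-filter⁺ (λ e → T? (S e)) (∈-allFin e) (subst T (sym e∈S) _)
  go : (es : List (Fin n)) → e ∈ es → P (minList (map (pos v) es))
  go []         ()
  go (e′ ∷ es) _ = foldr-⊓-preserves P P-⊓ (P-pos e′) (All.map⁺ (All.universal P-pos es))

1≤minPos : ∀ {n} (v : Vec (Fin n) n) (S : Subset n) → Nonempty S → 1 ℕ.≤ minPos v S
1≤minPos v S S≢∅ = minPos-preserves (1 ℕ.≤_) ℕ.⊓-glb v S S≢∅ (λ _ → ℕ.s≤s ℕ.z≤n)

minPos≤n : ∀ {n} (v : Vec (Fin n) n) (S : Subset n) → Nonempty S → minPos v S ℕ.≤ n
minPos≤n {n} v S S≢∅ =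
  minPos-preserves (ℕ._≤ n) (λ {_} {y} x≤n _ → ℕ.m≤n⇒m⊓o≤n y x≤n) v S S≢∅ (λ e → Fin.toℕ<n (lookup v e))

expectation : ∀ {n} → Distribution n → (Vec (Fin n) n → ℚ) → ℚ
expectation {n} δ X = Σv n (λ v → prob δ v * X v)

module _ {n : ℕ} where

  Σv-prob-sub≡0 : (δ δ' : Distribution n) → Σv n (λ v → prob δ' v - prob δ v) ≡ 0ℚ
  Σv-prob-sub≡0 δ δ' = begin
    Σv n (λ v → prob δ' v - prob δ v)            ≡⟨ sumℚ-map-+ (prob δ') (λ v → - prob δ v) (allVecs n n) ⟩
    Σv n (prob δ') + Σv n (λ v → - prob δ v)     ≡⟨ cong (_+_ (Σv n (prob δ'))) (sumℚ-map-neg (prob δ) (allVecs n n)) ⟩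
    Σv n (prob δ') - Σv n (prob δ)               ≡⟨ cong₂ _-_ (total δ') (total δ) ⟩
    1ℚ - 1ℚ                                      ≡⟨ +-inverseʳ 1ℚ ⟩
    0ℚ                                           ∎
    where open ≡-Reasoning

  0⊔-sub-≤-0⊔-sub-+ : ∀ p q → 0ℚ ⊔ (q - p) ≤ (0ℚ ⊔ (p - q)) + (q - p)
  0⊔-sub-≤-0⊔-sub-+ p q = ⊔-lub 0≤rhs (begin
      q - p                      ≡⟨ sym (+-identityˡ (q - p)) ⟩
      0ℚ + (q - p)               ≤⟨ +-monoˡ-≤ (q - p) (p≤p⊔q 0ℚ (p - q)) ⟩
      (0ℚ ⊔ (p - q)) + (q - p)   ∎)
    where
    open ≤-Reasoning
    0≤rhs : 0ℚ ≤ (0ℚ ⊔ (p - q)) + (q - p)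
    0≤rhs = begin
      0ℚ                         ≡⟨ solve 2 (λ p q → con 0ℚ := (p :- q) :+ (q :- p)) refl p q ⟩
      (p - q) + (q - p)          ≤⟨ +-monoˡ-≤ (q - p) (p≤q⊔p 0ℚ (p - q)) ⟩
      (0ℚ ⊔ (p - q)) + (q - p)   ∎

  dTV-sym-≤ : (δ δ' : Distribution n) → dTV δ' δ ≤ dTV δ δ'
  dTV-sym-≤ δ δ' = begin
    dTV δ' δ                                          ≤⟨ sumℚ-map-mono (λ v → 0⊔-sub-≤-0⊔-sub-+ (prob δ v) (prob δ' v)) (allVecs n n) ⟩
    Σv n (λ v → (0ℚ ⊔ (prob δ v - prob δ' v)) + (prob δ' v - prob δ v))
                                                      ≡⟨ sumℚ-map-+ _ _ (allVecs n n) ⟩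
    dTV δ δ' + Σv n (λ v → prob δ' v - prob δ v)      ≡⟨ cong (_+_ (dTV δ δ')) (Σv-prob-sub≡0 δ δ') ⟩
    dTV δ δ' + 0ℚ                                     ≡⟨ +-identityʳ (dTV δ δ') ⟩
    dTV δ δ'                                          ∎
    where open ≤-Reasoning

  *-≤-*-+-0⊔-sub : ∀ {M x} p q → 0ℚ ≤ x → x ≤ M → q * x ≤ p * x + M * (0ℚ ⊔ (q - p))
  *-≤-*-+-0⊔-sub {M} {x} p q 0≤x x≤M = begin
    q * x                       ≡⟨ solve 3 (λ p q x → q :* x := p :* x :+ (q :- p) :* x) refl p q x ⟩
    p * x + (q - p) * x         ≤⟨ +-monoʳ-≤ (p * x) (*-monoʳ-≤-nonNeg x (p≤q⊔p 0ℚ (q - p))) ⟩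
    p * x + d * x               ≤⟨ +-monoʳ-≤ (p * x) (*-monoˡ-≤-nonNeg d x≤M) ⟩
    p * x + d * M               ≡⟨ cong (_+_ (p * x)) (*-comm d M) ⟩
    p * x + M * d               ∎
    where
    open ≤-Reasoning
    d = 0ℚ ⊔ (q - p)
    instance
      _ : ℚ.NonNegative x
      _ = ℚ.nonNegative 0≤x
      _ : ℚ.NonNegative d
      _ = ℚ.nonNegative (p≤p⊔q 0ℚ (q - p))

  expectation-≤-+-dTV : (δ δ' : Distribution n) {M : ℚ} (X : Vec (Fin n) n → ℚ) →
                        (∀ v → 0ℚ ≤ X v) → (∀ v → X v ≤ M) →
                        expectation δ' X ≤ expectation δ X + M * dTV δ' δ
  expectation-≤-+-dTV δ δ' {M} X 0≤X X≤M = begin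
    expectation δ' X
      ≤⟨ sumℚ-map-mono (λ v → *-≤-*-+-0⊔-sub (prob δ v) (prob δ' v) (0≤X v) (X≤M v)) (allVecs n n) ⟩
    Σv n (λ v → prob δ v * X v + M * (0ℚ ⊔ (prob δ' v - prob δ v)))
      ≡⟨ sumℚ-map-+ _ _ (allVecs n n) ⟩
    expectation δ X + Σv n (λ v → M * (0ℚ ⊔ (prob δ' v - prob δ v)))
      ≡⟨ cong (_+_ (expectation δ X)) (sumℚ-map-*ˡ M _ (allVecs n n)) ⟩
    expectation δ X + M * dTV δ' δ
      ∎
    where open ≤-Reasoning

  ≤-expectation : (δ : Distribution n) {c : ℚ} (X : Vec (Fin n) n → ℚ) →
                  (∀ v → c ≤ X v) → c ≤ expectation δ X
  ≤-expectation δ {c} X c≤X = begin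
    c                          ≡⟨ sym (*-identityʳ c) ⟩
    c * 1ℚ                     ≡⟨ cong (c *_) (sym (total δ)) ⟩
    c * Σv n (prob δ)          ≡⟨ sym (sumℚ-map-*ˡ c (prob δ) (allVecs n n)) ⟩
    Σv n (λ v → c * prob δ v)  ≤⟨ sumℚ-map-mono c*p≤p*X (allVecs n n) ⟩
    expectation δ X            ∎
    where
    open ≤-Reasoning
    c*p≤p*X : ∀ v → c * prob δ v ≤ prob δ v * X v
    c*p≤p*X v = subst (_≤ prob δ v * X v) (*-comm (prob δ v) c)
      (*-monoˡ-≤-nonNeg (prob δ v) {{ℚ.nonNegative (nonneg δ v)}} (c≤X v))

lemma4 : (n : ℕ) .{{_ : NonZero n}} (δ δ' : Distribution n)
    → dTV δ δ' ≤ (+ 1) / n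
    → (r : ℕ) (S : Subset n) → card S ≡ r → Nonempty S
    → expMin δ' S ≤ (+ 2) / 1 * expMin δ S
lemma4 n δ δ' dTV≤1/n _ S _ S≢∅ = begin
    expMin δ' S                   ≤⟨ expectation-≤-+-dTV δ δ' X 0≤X X≤n ⟩
    E + ℕ→ℚ n * dTV δ' δ          ≤⟨ +-monoʳ-≤ E (*-monoˡ-≤-nonNeg (ℕ→ℚ n) dTV′≤1/n) ⟩
    E + ℕ→ℚ n * ((+ 1) / n)       ≡⟨ cong (_+_ E) (ℕ→ℚ-*-1/n n) ⟩
    E + 1ℚ                        ≤⟨ +-monoʳ-≤ E (≤-expectation δ X 1≤X) ⟩
    E + E                         ≡⟨ cong₂ _+_ (sym (*-identityˡ E)) (sym (*-identityˡ E)) ⟩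
    1ℚ * E + 1ℚ * E               ≡⟨ sym (*-distribʳ-+ E 1ℚ 1ℚ) ⟩
    (+ 2) / 1 * E                 ∎
  where
  open ≤-Reasoning
  X : Vec (Fin n) n → ℚ
  X v = ℕ→ℚ (minPos v S)
  E : ℚ
  E = expMin δ S
  0≤X : ∀ v → 0ℚ ≤ X v
  0≤X v = ℕ→ℚ-mono-≤ {0} {minPos v S} ℕ.z≤n
  1≤X : ∀ v → 1ℚ ≤ X v
  1≤X v = ℕ→ℚ-mono-≤ {1} {minPos v S} (1≤minPos v S S≢∅)
  X≤n : ∀ v → X v ≤ ℕ→ℚ n
  X≤n v = ℕ→ℚ-mono-≤ {minPos v S} (minPos≤n v S S≢∅)
  dTV′≤1/n : dTV δ' δ ≤ (+ 1) / n
  dTV′≤1/n = ≤-trans (dTV-sym-≤ δ δ') dTV≤1/n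
  instance
    _ : ℚ.NonNegative (ℕ→ℚ n)
    _ = ℚ.nonNegative (ℕ→ℚ-mono-≤ {0} {n} ℕ.z≤n)
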